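{- A18 is not provable from $\mathrm{PA}^-\cup\{\mathbf{GS}^s\}$, where $\mathbf{GS}^s$ is the sentence: for every prime $p$ there exists $n$ such that $n$ is $p$-good and no $m$ with $n<m$ is $p$-good.
   Context: Language $\{+,\cdot,0,1,<\}$. $\mathrm{PA}^-$ is axiomatized by (universal closures of) A1 $(x+y)+z=x+(y+z)$; A2 $x+y=y+x$; A3 $(xy)z=x(yz)$; A4 $xy=yx$; A5 $x(y+z)=xy+xz$; A6 $x+0=x\wedge x\cdot 0=0$; A7 $x\cdot1=x$; A8 $x<y\wedge y<z\to x<z$; A9 $\neg x<x$; A10 $x<y\vee x=y\vee y<x$; A11 $x<y\to x+z<y+z$; A12 $0<z\wedge x<y\to xz<yz$; A13 $x<y\to\exists z\,(x+z=y)$; A14 $0<1\wedge(x>0\to x\ge 1)$; A15 $x>0\vee x=0$. Notation: $\bar k$ is the numeral with $k$ ones; $x\mid y$ means $\exists z\,(xz=y)$; $m,n$ are relatively prime if every common divisor of $m,n$ equals $1$; $x$ is prime means $1<x$ and for all $a,b,c$, if $xc=ab$ then $x\mid a$ or $x\mid b$. For a prime $p$, $n$ is $p$-good if every $t$ with $1<t<n$, $t$ relatively prime to $n$, and $v$ relatively prime to $t$ for every prime $v\le p$, is prime. A18: for every $n>\bar4$ there is a prime $p$ with $p^2<n$ such that $n\le q^2$ for every prime $q>p$. -}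

module Defs where

open import Data.Nat using (ℕ; zero; suc)

-- First-order syntax for the language {+, ·, 0, 1, <} (with equality).
-- Variables are de Bruijn indices (var 0 = innermost bound variable).

infixl 7 _*'_
infixl 6 _+'_
infix  4 _≐_ _<'_ _≤'_
infixr 2 _⇒_
infixr 3 _∨'_
infixr 4 _∧'_

data Term : Set where
  var  : ℕ → Term
  0'   : Term
  1'   : Term
  _+'_ : Term → Term → Term
  _*'_ : Term → Term → Term

data Formula : Set where
  _≐_  : Term → Term → Formula
  _<'_ : Term → Term → Formula
  ⊥'   : Formula
  _⇒_  : Formula → Formula → Formula
  ∀'   : Formula → Formula

ext : (ℕ → ℕ) → ℕ → ℕ
ext ρ zero    = zero
ext ρ (suc n) = suc (ρ n)

renT : (ℕ → ℕ) → Term → Term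
renT ρ (var n)  = var (ρ n)
renT ρ 0'       = 0'
renT ρ 1'       = 1'
renT ρ (s +' t) = renT ρ s +' renT ρ t
renT ρ (s *' t) = renT ρ s *' renT ρ t

ren : (ℕ → ℕ) → Formula → Formula
ren ρ (s ≐ t)  = renT ρ s ≐ renT ρ t
ren ρ (s <' t) = renT ρ s <' renT ρ t
ren ρ ⊥'       = ⊥'
ren ρ (φ ⇒ ψ)  = ren ρ φ ⇒ ren ρ ψ
ren ρ (∀' φ)   = ∀' (ren (ext ρ) φ)

↑ : Term → Term
↑ = renT suc

shift : Formula → Formula
shift = ren suc

exts : (ℕ → Term) → ℕ → Term
exts σ zero    = var zero
exts σ (suc n) = ↑ (σ n)

subT : (ℕ → Term) → Term → Term
subT σ (var n)  = σ n
subT σ 0'       = 0'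
subT σ 1'       = 1'
subT σ (s +' t) = subT σ s +' subT σ t
subT σ (s *' t) = subT σ s *' subT σ t

sub : (ℕ → Term) → Formula → Formula
sub σ (s ≐ t)  = subT σ s ≐ subT σ t
sub σ (s <' t) = subT σ s <' subT σ t
sub σ ⊥'       = ⊥'
sub σ (φ ⇒ ψ)  = sub σ φ ⇒ sub σ ψ
sub σ (∀' φ)   = ∀' (sub (exts σ) φ)

single : Term → ℕ → Term
single t zero    = t
single t (suc n) = var n

_[_] : Formula → Term → Formula
φ [ t ] = sub (single t) φ

¬' : Formula → Formula
¬' φ = φ ⇒ ⊥'

_∨'_ : Formula → Formula → Formula
φ ∨' ψ = ¬' φ ⇒ ψ

_∧'_ : Formula → Formula → Formula
φ ∧' ψ = ¬' (φ ⇒ ¬' ψ)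

∃' : Formula → Formula
∃' φ = ¬' (∀' (¬' φ))

_≤'_ : Term → Term → Formula
s ≤' t = (s <' t) ∨' (s ≐ t)

-- Hilbert-style first-order calculus (Enderton style: logical axioms are
-- closed under generalization; the only rule is modus ponens).

data LogAx : Formula → Set where
  ax-K   : ∀ φ ψ → LogAx (φ ⇒ ψ ⇒ φ)
  ax-S   : ∀ φ ψ χ → LogAx ((φ ⇒ ψ ⇒ χ) ⇒ (φ ⇒ ψ) ⇒ φ ⇒ χ)
  ax-DN  : ∀ φ → LogAx (¬' (¬' φ) ⇒ φ)
  ax-inst : ∀ φ t → LogAx (∀' φ ⇒ φ [ t ])
  ax-dist : ∀ φ ψ → LogAx (∀' (φ ⇒ ψ) ⇒ ∀' φ ⇒ ∀' ψ)
  ax-vac  : ∀ φ → LogAx (φ ⇒ ∀' (shift φ))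
  ax-refl : ∀ t → LogAx (t ≐ t)
  ax-cong+ : ∀ s s' t t' → LogAx (s ≐ s' ⇒ t ≐ t' ⇒ s +' t ≐ s' +' t')
  ax-cong* : ∀ s s' t t' → LogAx (s ≐ s' ⇒ t ≐ t' ⇒ s *' t ≐ s' *' t')
  ax-cong≐ : ∀ s s' t t' → LogAx (s ≐ s' ⇒ t ≐ t' ⇒ s ≐ t ⇒ s' ≐ t')
  ax-cong< : ∀ s s' t t' → LogAx (s ≐ s' ⇒ t ≐ t' ⇒ s <' t ⇒ s' <' t')
  ax-gen  : ∀ {φ} → LogAx φ → LogAx (∀' φ)

data _⊢_ (Γ : Formula → Set) : Formula → Set where
  hyp : ∀ {φ} → Γ φ → Γ ⊢ φ
  log : ∀ {φ} → LogAx φ → Γ ⊢ φ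
  mp  : ∀ {φ ψ} → Γ ⊢ (φ ⇒ ψ) → Γ ⊢ φ → Γ ⊢ ψ

numeral : ℕ → Term
numeral zero          = 0'
numeral (suc zero)    = 1'
numeral (suc (suc k)) = numeral (suc k) +' 1'

v0 v1 v2 : Term
v0 = var 0
v1 = var 1
v2 = var 2

A1 A2 A3 A4 A5 A6 A7 A8 A9 A10 A11 A12 A13 A14 A15 : Formula
A1  = ∀' (∀' (∀' ((v2 +' v1) +' v0 ≐ v2 +' (v1 +' v0))))
A2  = ∀' (∀' (v1 +' v0 ≐ v0 +' v1))
A3  = ∀' (∀' (∀' ((v2 *' v1) *' v0 ≐ v2 *' (v1 *' v0))))
A4  = ∀' (∀' (v1 *' v0 ≐ v0 *' v1))
A5  = ∀' (∀' (∀' (v2 *' (v1 +' v0) ≐ v2 *' v1 +' v2 *' v0)))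
A6  = ∀' ((v0 +' 0' ≐ v0) ∧' (v0 *' 0' ≐ 0'))
A7  = ∀' (v0 *' 1' ≐ v0)
A8  = ∀' (∀' (∀' ((v2 <' v1) ∧' (v1 <' v0) ⇒ v2 <' v0)))
A9  = ∀' (¬' (v0 <' v0))
A10 = ∀' (∀' ((v1 <' v0) ∨' (v1 ≐ v0) ∨' (v0 <' v1)))
A11 = ∀' (∀' (∀' (v2 <' v1 ⇒ v2 +' v0 <' v1 +' v0)))
A12 = ∀' (∀' (∀' ((0' <' v0) ∧' (v2 <' v1) ⇒ v2 *' v0 <' v1 *' v0)))
A13 = ∀' (∀' (v1 <' v0 ⇒ ∃' (v2 +' v0 ≐ v1)))
A14 = ∀' ((0' <' 1') ∧' (0' <' v0 ⇒ 1' ≤' v0))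
A15 = ∀' ((0' <' v0) ∨' (v0 ≐ 0'))

divides : Term → Term → Formula
divides s t = ∃' (↑ s *' v0 ≐ ↑ t)

relPrime : Term → Term → Formula
relPrime s t = ∀' ((divides v0 (↑ s) ∧' divides v0 (↑ t)) ⇒ v0 ≐ 1')

prime : Term → Formula
prime x = (1' <' x) ∧'
  ∀' (∀' (∀' ((x' *' v0 ≐ v2 *' v1) ⇒ divides x' v2 ∨' divides x' v1)))
  where x' = ↑ (↑ (↑ x))

-- n is p-good: every t with 1 < t < n, t rel. prime to n, and every prime
-- v ≤ p rel. prime to t, is prime.
good : Term → Term → Formula
good p n = ∀' (((1' <' v0) ∧' (v0 <' ↑ n) ∧' relPrime v0 (↑ n)
              ∧' ∀' ((prime v0 ∧' (v0 ≤' ↑ (↑ p))) ⇒ relPrime v0 v1))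
              ⇒ prime v0)

GSs : Formula
GSs = ∀' (prime v0 ⇒ ∃' (good v1 v0 ∧' ∀' (v1 <' v0 ⇒ ¬' (good v2 v0))))

-- A18 : ∀ n (4̄ < n → ∃ p (p prime ∧ p·p < n ∧ ∀ q (q prime ∧ p < q → n ≤ q·q)))
A18 : Formula
A18 = ∀' (numeral 4 <' v0 ⇒
        ∃' (prime v0 ∧' (v0 *' v0 <' v1) ∧'
            ∀' ((prime v0 ∧' (v1 <' v0)) ⇒ v2 ≤' v0 *' v0)))

data PA⁻+GSs : Formula → Set where
  a1 : PA⁻+GSs A1
  a2 : PA⁻+GSs A2
  a3 : PA⁻+GSs A3
  a4 : PA⁻+GSs A4
  a5 : PA⁻+GSs A5
  a6 : PA⁻+GSs A6
  a7 : PA⁻+GSs A7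
  a8 : PA⁻+GSs A8
  a9 : PA⁻+GSs A9
  a10 : PA⁻+GSs A10
  a11 : PA⁻+GSs A11
  a12 : PA⁻+GSs A12
  a13 : PA⁻+GSs A13
  a14 : PA⁻+GSs A14
  a15 : PA⁻+GSs A15
  gs  : PA⁻+GSs GSs

-- A countermodel. Read a finitely supported integer sequence a as the divided-power
-- polynomial Σ aₙ Xⁿ/n!. These form a ring ℤ⟨X⟩, ordered by the sign of the leading
-- coefficient, whose nonnegative part ℳ is a model of PA⁻ with standard part ℕ. Equality
-- and order in ℳ are decidable, so the Tarski semantics validates ¬¬φ → φ and the calculus
-- is sound for ℳ.
--
-- No standard q > 1 is prime in ℳ: X · X^[q-1] = q · X^[q], yet q divides neither factor,
-- each having a coefficient equal to 1. Hence A18 fails at n = 5, since a prime p with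
-- p² < 5 would be the standard number 2. And GS^s holds with n = 2: 2 is vacuously p-good,
-- while for m > 2 some standard prime q < m does not divide m (a prime factor of m - 1, or
-- of L + 1 for the leading coefficient L of an infinite m); such a q is coprime to m and
-- to every prime of ℳ but is not prime, so m is not p-good.

module Submission where

open import Defs
open import Data.Nat.Base as ℕ using (ℕ; zero; suc; z≤n; s≤s)
import Data.Nat.Properties as ℕ
import Data.Nat.Divisibility as ℕ
open import Data.Nat.Primality using (Prime; prime⇒nonTrivial; prime⇒irreducible)
open import Data.Nat.Primality.Factorisation using (factorise)
open import Data.Nat.ListAction using (product)
import Data.Integer.Properties as ℤ
open import Data.Integer.Tactic.RingSolver using (solve-∀)
import Data.List.Base as List
import Data.List.Relation.Unary.All as All
open import Data.Product.Base using (Σ-syntax; _×_; _,_)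
open import Data.Sum.Base using (_⊎_; inj₁; inj₂)
open import Data.Empty using (⊥; ⊥-elim)
open import Function.Base using (id; _∘_; _on_)
open import Function.Bundles using (_⇔_; mk⇔; Equivalence)
open import Function.Related.TypeIsomorphisms using (→-cong-⇔)
open import Level using (0ℓ)
open import Relation.Nullary using (¬_; Dec; yes; no; Stable)
open import Relation.Nullary.Decidable using (decidable-stable)
open import Relation.Binary.Bundles using (Setoid)
open import Relation.Binary.Structures using (IsEquivalence)
open import Relation.Binary.Definitions using (tri<; tri≈; tri>; Trichotomous)
open import Relation.Binary.PropositionalEquality
  using (_≡_; _≢_; refl; sym; trans; cong; cong₂; subst; _≗_; module ≡-Reasoning)
import Relation.Binary.Reasoning.Setoid as SetoidReasoning
import Relation.Binary.Construct.On as On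
open import Algebra.Properties.CommutativeSemigroup ℤ.+-commutativeSemigroup using (interchange)

record Structure : Set₁ where
  infix  4 _≈_ _<_
  infixl 6 _+_
  infixl 7 _*_
  field
    Carrier       : Set
    _≈_ _<_       : Carrier → Carrier → Set
    _+_ _*_       : Carrier → Carrier → Carrier
    0# 1#         : Carrier
    isEquivalence : IsEquivalence _≈_
    +-cong        : ∀ {x x′ y y′} → x ≈ x′ → y ≈ y′ → x + y ≈ x′ + y′
    *-cong        : ∀ {x x′ y y′} → x ≈ x′ → y ≈ y′ → x * y ≈ x′ * y′
    <-resp        : ∀ {x x′ y y′} → x ≈ x′ → y ≈ y′ → x < y → x′ < y′
    ≈-stable      : ∀ {x y} → Stable (x ≈ y)
    <-stable      : ∀ {x y} → Stable (x < y)

  open IsEquivalence isEquivalence public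
    using () renaming (refl to ≈-refl; sym to ≈-sym; trans to ≈-trans)

  ≈-resp : ∀ {x x′ y y′} → x ≈ x′ → y ≈ y′ → x ≈ y → x′ ≈ y′
  ≈-resp x≈x′ y≈y′ x≈y = ≈-trans (≈-sym x≈x′) (≈-trans x≈y y≈y′)

module Semantics (𝔐 : Structure) where

  open Structure 𝔐

  Env : Set
  Env = ℕ → Carrier

  infixr 5 _∷_

  _∷_ : Carrier → Env → Env
  (d ∷ ρ) zero    = d
  (d ∷ ρ) (suc n) = ρ n

  ⟦_⟧ₜ : Term → Env → Carrier
  ⟦ var n  ⟧ₜ ρ = ρ n
  ⟦ 0'     ⟧ₜ ρ = 0#
  ⟦ 1'     ⟧ₜ ρ = 1#
  ⟦ s +' t ⟧ₜ ρ = ⟦ s ⟧ₜ ρ + ⟦ t ⟧ₜ ρ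
  ⟦ s *' t ⟧ₜ ρ = ⟦ s ⟧ₜ ρ * ⟦ t ⟧ₜ ρ

  ⟦_⟧ : Formula → Env → Set
  ⟦ s ≐ t  ⟧ ρ = ⟦ s ⟧ₜ ρ ≈ ⟦ t ⟧ₜ ρ
  ⟦ s <' t ⟧ ρ = ⟦ s ⟧ₜ ρ < ⟦ t ⟧ₜ ρ
  ⟦ ⊥'     ⟧ ρ = ⊥
  ⟦ φ ⇒ ψ  ⟧ ρ = ⟦ φ ⟧ ρ → ⟦ ψ ⟧ ρ
  ⟦ ∀' φ   ⟧ ρ = ∀ d → ⟦ φ ⟧ (d ∷ ρ)

  ⟦⟧-stable : ∀ φ ρ → Stable (⟦ φ ⟧ ρ)
  ⟦⟧-stable (s ≐ t)  ρ = ≈-stable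
  ⟦⟧-stable (s <' t) ρ = <-stable
  ⟦⟧-stable ⊥'       ρ ¬¬⊥   = ¬¬⊥ id
  ⟦⟧-stable (φ ⇒ ψ)  ρ ¬¬φ⇒ψ a = ⟦⟧-stable ψ ρ λ ¬b → ¬¬φ⇒ψ λ φ⇒ψ → ¬b (φ⇒ψ a)
  ⟦⟧-stable (∀' φ)   ρ ¬¬∀φ  d = ⟦⟧-stable φ (d ∷ ρ) λ ¬φd → ¬¬∀φ λ ∀φ → ¬φd (∀φ d)

  infix 4 _∤_ _∣_

  _∤_ _∣_ : Carrier → Carrier → Set
  x ∤ y = ∀ z → ¬ x * z ≈ y
  x ∣ y = ¬ x ∤ y

  -- ⟦ prime v0 ⟧ (x ∷ ρ) and ⟦ relPrime v0 v1 ⟧ (a ∷ b ∷ ρ) unfold to these, whatever ρ is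
  IsPrime : Carrier → Set
  IsPrime x = ¬ (1# < x → ¬ (∀ a b c → x * c ≈ a * b → ¬ x ∣ a → x ∣ b))

  Coprime : Carrier → Carrier → Set
  Coprime a b = ∀ d → ¬ (d ∣ a → ¬ d ∣ b) → d ≈ 1#

  Coprime-sym : ∀ {a b} → Coprime a b → Coprime b a
  Coprime-sym a⊥b d d∣b∧d∣a = a⊥b d λ k → d∣b∧d∣a λ d∣b d∣a → k d∣a d∣b

  private
    atomic⇔ : {R : Carrier → Carrier → Set} →
              (∀ {x x′ y y′} → x ≈ x′ → y ≈ y′ → R x y → R x′ y′) →
              ∀ {x x′ y y′} → x ≈ x′ → y ≈ y′ → R x y ⇔ R x′ y′
    atomic⇔ resp x≈x′ y≈y′ = mk⇔ (resp x≈x′ y≈y′) (resp (≈-sym x≈x′) (≈-sym y≈y′))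

    ∀-cong⇔ : {A B : Carrier → Set} → (∀ d → A d ⇔ B d) → (∀ d → A d) ⇔ (∀ d → B d)
    ∀-cong⇔ A⇔B =
      mk⇔ (λ a d → Equivalence.to (A⇔B d) (a d)) (λ b d → Equivalence.from (A⇔B d) (b d))

  ⟦⟧ₜ-cong : ∀ t {ρ ρ′} → (∀ n → ρ n ≈ ρ′ n) → ⟦ t ⟧ₜ ρ ≈ ⟦ t ⟧ₜ ρ′
  ⟦⟧ₜ-cong (var n)  ρ≈ρ′ = ρ≈ρ′ n
  ⟦⟧ₜ-cong 0'       ρ≈ρ′ = ≈-refl
  ⟦⟧ₜ-cong 1'       ρ≈ρ′ = ≈-refl
  ⟦⟧ₜ-cong (s +' t) ρ≈ρ′ = +-cong (⟦⟧ₜ-cong s ρ≈ρ′) (⟦⟧ₜ-cong t ρ≈ρ′)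
  ⟦⟧ₜ-cong (s *' t) ρ≈ρ′ = *-cong (⟦⟧ₜ-cong s ρ≈ρ′) (⟦⟧ₜ-cong t ρ≈ρ′)

  ⟦⟧-cong : ∀ φ {ρ ρ′} → (∀ n → ρ n ≈ ρ′ n) → ⟦ φ ⟧ ρ ⇔ ⟦ φ ⟧ ρ′
  ⟦⟧-cong (s ≐ t)  ρ≈ρ′ = atomic⇔ ≈-resp (⟦⟧ₜ-cong s ρ≈ρ′) (⟦⟧ₜ-cong t ρ≈ρ′)
  ⟦⟧-cong (s <' t) ρ≈ρ′ = atomic⇔ <-resp (⟦⟧ₜ-cong s ρ≈ρ′) (⟦⟧ₜ-cong t ρ≈ρ′)
  ⟦⟧-cong ⊥'       ρ≈ρ′ = mk⇔ id id
  ⟦⟧-cong (φ ⇒ ψ)  ρ≈ρ′ = →-cong-⇔ (⟦⟧-cong φ ρ≈ρ′) (⟦⟧-cong ψ ρ≈ρ′)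
  ⟦⟧-cong (∀' φ)   ρ≈ρ′ = ∀-cong⇔ λ d → ⟦⟧-cong φ λ where
    zero    → ≈-refl
    (suc n) → ρ≈ρ′ n

  ⟦⟧ₜ-ren : ∀ r t {ρ ρ′} → (∀ n → ρ (r n) ≈ ρ′ n) → ⟦ renT r t ⟧ₜ ρ ≈ ⟦ t ⟧ₜ ρ′
  ⟦⟧ₜ-ren r (var n)  ρr≈ρ′ = ρr≈ρ′ n
  ⟦⟧ₜ-ren r 0'       ρr≈ρ′ = ≈-refl
  ⟦⟧ₜ-ren r 1'       ρr≈ρ′ = ≈-refl
  ⟦⟧ₜ-ren r (s +' t) ρr≈ρ′ = +-cong (⟦⟧ₜ-ren r s ρr≈ρ′) (⟦⟧ₜ-ren r t ρr≈ρ′)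
  ⟦⟧ₜ-ren r (s *' t) ρr≈ρ′ = *-cong (⟦⟧ₜ-ren r s ρr≈ρ′) (⟦⟧ₜ-ren r t ρr≈ρ′)

  ⟦⟧-ren : ∀ φ r {ρ ρ′} → (∀ n → ρ (r n) ≈ ρ′ n) → ⟦ ren r φ ⟧ ρ ⇔ ⟦ φ ⟧ ρ′
  ⟦⟧-ren (s ≐ t)  r ρr≈ρ′ = atomic⇔ ≈-resp (⟦⟧ₜ-ren r s ρr≈ρ′) (⟦⟧ₜ-ren r t ρr≈ρ′)
  ⟦⟧-ren (s <' t) r ρr≈ρ′ = atomic⇔ <-resp (⟦⟧ₜ-ren r s ρr≈ρ′) (⟦⟧ₜ-ren r t ρr≈ρ′)
  ⟦⟧-ren ⊥'       r ρr≈ρ′ = mk⇔ id id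
  ⟦⟧-ren (φ ⇒ ψ)  r ρr≈ρ′ = →-cong-⇔ (⟦⟧-ren φ r ρr≈ρ′) (⟦⟧-ren ψ r ρr≈ρ′)
  ⟦⟧-ren (∀' φ)   r ρr≈ρ′ = ∀-cong⇔ λ d → ⟦⟧-ren φ (ext r) λ where
    zero    → ≈-refl
    (suc n) → ρr≈ρ′ n

  ⟦⟧ₜ-sub : ∀ σ t {ρ ρ′} → (∀ n → ⟦ σ n ⟧ₜ ρ ≈ ρ′ n) → ⟦ subT σ t ⟧ₜ ρ ≈ ⟦ t ⟧ₜ ρ′
  ⟦⟧ₜ-sub σ (var n)  ρσ≈ρ′ = ρσ≈ρ′ n
  ⟦⟧ₜ-sub σ 0'       ρσ≈ρ′ = ≈-refl
  ⟦⟧ₜ-sub σ 1'       ρσ≈ρ′ = ≈-refl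
  ⟦⟧ₜ-sub σ (s +' t) ρσ≈ρ′ = +-cong (⟦⟧ₜ-sub σ s ρσ≈ρ′) (⟦⟧ₜ-sub σ t ρσ≈ρ′)
  ⟦⟧ₜ-sub σ (s *' t) ρσ≈ρ′ = *-cong (⟦⟧ₜ-sub σ s ρσ≈ρ′) (⟦⟧ₜ-sub σ t ρσ≈ρ′)

  ⟦⟧-sub : ∀ φ σ {ρ ρ′} → (∀ n → ⟦ σ n ⟧ₜ ρ ≈ ρ′ n) → ⟦ sub σ φ ⟧ ρ ⇔ ⟦ φ ⟧ ρ′
  ⟦⟧-sub (s ≐ t)  σ ρσ≈ρ′ = atomic⇔ ≈-resp (⟦⟧ₜ-sub σ s ρσ≈ρ′) (⟦⟧ₜ-sub σ t ρσ≈ρ′)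
  ⟦⟧-sub (s <' t) σ ρσ≈ρ′ = atomic⇔ <-resp (⟦⟧ₜ-sub σ s ρσ≈ρ′) (⟦⟧ₜ-sub σ t ρσ≈ρ′)
  ⟦⟧-sub ⊥'       σ ρσ≈ρ′ = mk⇔ id id
  ⟦⟧-sub (φ ⇒ ψ)  σ ρσ≈ρ′ = →-cong-⇔ (⟦⟧-sub φ σ ρσ≈ρ′) (⟦⟧-sub ψ σ ρσ≈ρ′)
  ⟦⟧-sub (∀' φ)   σ {ρ} ρσ≈ρ′ = ∀-cong⇔ λ d → ⟦⟧-sub φ (exts σ) λ where
    zero    → ≈-refl
    (suc n) → ≈-trans (⟦⟧ₜ-ren suc (σ n) {d ∷ ρ} (λ _ → ≈-refl)) (ρσ≈ρ′ n)

  infix 4 ⊨_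

  ⊨_ : Formula → Set
  ⊨ φ = ∀ ρ → ⟦ φ ⟧ ρ

  LogAx-sound : ∀ {φ} → LogAx φ → ⊨ φ
  LogAx-sound (ax-K φ ψ)           ρ a _         = a
  LogAx-sound (ax-S φ ψ χ)         ρ f g a       = f a (g a)
  LogAx-sound (ax-DN φ)            ρ             = ⟦⟧-stable φ ρ
  LogAx-sound (ax-inst φ t)        ρ ∀φ          = Equivalence.from (⟦⟧-sub φ (single t) λ where
    zero    → ≈-refl
    (suc n) → ≈-refl) (∀φ (⟦ t ⟧ₜ ρ))
  LogAx-sound (ax-dist φ ψ)        ρ ∀φ⇒ψ ∀φ d = ∀φ⇒ψ d (∀φ d)
  LogAx-sound (ax-vac φ)           ρ a d         =
    Equivalence.from (⟦⟧-ren φ suc {d ∷ ρ} λ _ → ≈-refl) a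
  LogAx-sound (ax-refl t)          ρ             = ≈-refl
  LogAx-sound (ax-cong+ s s′ t t′) ρ             = +-cong
  LogAx-sound (ax-cong* s s′ t t′) ρ             = *-cong
  LogAx-sound (ax-cong≐ s s′ t t′) ρ             = ≈-resp
  LogAx-sound (ax-cong< s s′ t t′) ρ             = <-resp
  LogAx-sound (ax-gen ax)          ρ d           = LogAx-sound ax (d ∷ ρ)

  sound : ∀ {Γ φ} → (∀ {ψ} → Γ ψ → ⊨ ψ) → Γ ⊢ φ → ⊨ φ
  sound ⊨Γ (hyp γ)     = ⊨Γ γ
  sound ⊨Γ (log ax)    = LogAx-sound ax
  sound ⊨Γ (mp d d′) ρ = sound ⊨Γ d ρ (sound ⊨Γ d′ ρ)

-- imported only here, as its _+_, _*_ and _<_ would clash with the fields of Structure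
open import Data.Integer.Base using (ℤ; +_; 0ℤ; 1ℤ; _+_; _*_; -_; _-_; _<_; +<+; ∣_∣)

private
  variable
    i j : ℤ
    k l n q : ℕ

+-pos : 0ℤ < i → 0ℤ < j → 0ℤ < i + j
+-pos = ℤ.+-mono-<

i≡0⇒i+j≡j : i ≡ 0ℤ → i + j ≡ j
i≡0⇒i+j≡j {j = j} refl = ℤ.+-identityˡ j

j≡0⇒i+j≡i : j ≡ 0ℤ → i + j ≡ i
j≡0⇒i+j≡i {i = i} refl = ℤ.+-identityʳ i

*-pos : 0ℤ < i → 0ℤ < j → 0ℤ < i * j
*-pos {+ suc _} {+ suc _} _         _         = +<+ (s≤s z≤n)
*-pos {+ 0}     {_}       (+<+ ()) _
*-pos {+ suc _} {+ 0}     _         (+<+ ())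

0<⇒+suc : 0ℤ < i → Σ[ m ∈ ℕ ] i ≡ + suc m
0<⇒+suc {+ suc m} _        = m , refl
0<⇒+suc {+ zero}  (+<+ ())

prime⇒1< : Prime q → 1 ℕ.< q
prime⇒1< {q} q-prime = ℕ.nonTrivial⇒n>1 q {{prime⇒nonTrivial q-prime}}

primeDivisor : 1 ℕ.< n → Σ[ p ∈ ℕ ] Prime p × p ℕ.∣ n
primeDivisor {suc zero} (s≤s ())
primeDivisor {n@(suc (suc _))} _ with factorise n
... | record { factors = p List.∷ ps ; isFactorisation = n≡p*Πps
             ; factorsPrime = p-prime All.∷ _ } =
  p , p-prime , ℕ.divides (product ps) (trans n≡p*Πps (ℕ.*-comm p (product ps)))
... | record { factors = List.[] ; isFactorisation = () }

1<⇒∤1 : 1 ℕ.< q → ¬ q ℕ.∣ 1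
1<⇒∤1 q>1 q∣1 = ℕ.<-irrefl (sym (ℕ.∣1⇒≡1 q∣1)) q>1

1<⇒∤suc : 1 ℕ.< q → q ℕ.∣ n → ¬ q ℕ.∣ suc n
1<⇒∤suc {q} {n} q>1 q∣n q∣1+n =
  1<⇒∤1 q>1 (ℕ.∣m+n∣m⇒∣n (subst (q ℕ.∣_) (ℕ.+-comm 1 n) q∣1+n) q∣n)

1<n∧n*n<5⇒n≡2 : 1 ℕ.< n → n ℕ.* n ℕ.< 5 → n ≡ 2
1<n∧n*n<5⇒n≡2 {2}                 _ _     = refl
1<n∧n*n<5⇒n≡2 {suc zero}          (s≤s ())
1<n∧n*n<5⇒n≡2 {n@(suc (suc (suc j)))} _ n²<5 =
  ⊥-elim (ℕ.<⇒≱ n²<5 (ℕ.≤-trans (ℕ.m≤m+n 5 4) (ℕ.*-mono-≤ {3} {n} {3} {n} 3≤n 3≤n)))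
  where
  3≤n : 3 ℕ.≤ n
  3≤n = s≤s (s≤s (s≤s z≤n))

Seq : Set
Seq = ℕ → ℤ

private
  variable
    f f′ g g′ : Seq

0ₛ : Seq
0ₛ _ = 0ℤ

infixl 6 _+ₛ_

_+ₛ_ : Seq → Seq → Seq
(f +ₛ g) n = f n + g n

-ₛ_ : Seq → Seq
(-ₛ f) n = - f n

∂ : Seq → Seq
∂ f n = f (suc n)

infixl 7 _⋆_

-- With a standing for Σ aₙ Xⁿ/n!, ∂ is d/dX, and the product is fixed by its constant term
-- and the Leibniz rule ∂(f g) = ∂f g + f ∂g. Below, mono c k stands for c Xᵏ/k!.
_⋆_ : Seq → Seq → Seq
(f ⋆ g) zero    = f 0 * g 0
(f ⋆ g) (suc n) = (∂ f ⋆ g) n + (f ⋆ ∂ g) n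

mono : ℤ → ℕ → Seq
mono c zero    zero    = c
mono c zero    (suc n) = 0ℤ
mono c (suc k) zero    = 0ℤ
mono c (suc k) (suc n) = mono c k n

ι : ℤ → Seq
ι c = mono c 0

X : Seq
X = mono 1ℤ 1

⋆-cong : f ≗ f′ → g ≗ g′ → f ⋆ g ≗ f′ ⋆ g′
⋆-cong f≗f′ g≗g′ zero    = cong₂ _*_ (f≗f′ 0) (g≗g′ 0)
⋆-cong f≗f′ g≗g′ (suc n) =
  cong₂ _+_ (⋆-cong (f≗f′ ∘ suc) g≗g′ n) (⋆-cong f≗f′ (g≗g′ ∘ suc) n)

⋆-comm : ∀ f g → f ⋆ g ≗ g ⋆ f
⋆-comm f g zero    = ℤ.*-comm (f 0) (g 0)
⋆-comm f g (suc n) =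
  trans (cong₂ _+_ (⋆-comm (∂ f) g n) (⋆-comm f (∂ g) n)) (ℤ.+-comm ((g ⋆ ∂ f) n) ((∂ g ⋆ f) n))

⋆-zeroˡ : f ≗ 0ₛ → f ⋆ g ≗ 0ₛ
⋆-zeroˡ {g = g} f≗0 zero = trans (cong (_* g 0) (f≗0 0)) (ℤ.*-zeroˡ (g 0))
⋆-zeroˡ f≗0 (suc n) = cong₂ _+_ (⋆-zeroˡ (f≗0 ∘ suc) n) (⋆-zeroˡ f≗0 n)

⋆-zeroʳ : g ≗ 0ₛ → f ⋆ g ≗ 0ₛ
⋆-zeroʳ {g} {f} g≗0 n = trans (⋆-comm f g n) (⋆-zeroˡ g≗0 n)

⋆-distribʳ : ∀ f g h → (f +ₛ g) ⋆ h ≗ f ⋆ h +ₛ g ⋆ h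
⋆-distribʳ f g h zero    = ℤ.*-distribʳ-+ (h 0) (f 0) (g 0)
⋆-distribʳ f g h (suc n) =
  trans (cong₂ _+_ (⋆-distribʳ (∂ f) (∂ g) h n) (⋆-distribʳ f g (∂ h) n))
        (interchange ((∂ f ⋆ h) n) ((∂ g ⋆ h) n) ((f ⋆ ∂ h) n) ((g ⋆ ∂ h) n))

⋆-distribˡ : ∀ f g h → f ⋆ (g +ₛ h) ≗ f ⋆ g +ₛ f ⋆ h
⋆-distribˡ f g h n = begin
  (f ⋆ (g +ₛ h)) n          ≡⟨ ⋆-comm f (g +ₛ h) n ⟩
  ((g +ₛ h) ⋆ f) n          ≡⟨ ⋆-distribʳ g h f n ⟩
  (g ⋆ f) n + (h ⋆ f) n     ≡⟨ cong₂ _+_ (⋆-comm g f n) (⋆-comm h f n) ⟩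
  (f ⋆ g) n + (f ⋆ h) n     ∎
  where open ≡-Reasoning

⋆-assoc : ∀ f g h → (f ⋆ g) ⋆ h ≗ f ⋆ (g ⋆ h)
⋆-assoc f g h zero    = ℤ.*-assoc (f 0) (g 0) (h 0)
⋆-assoc f g h (suc n) = begin
  (∂ (f ⋆ g) ⋆ h) n + ((f ⋆ g) ⋆ ∂ h) n
    ≡⟨ cong (_+ ((f ⋆ g) ⋆ ∂ h) n) (⋆-distribʳ (∂ f ⋆ g) (f ⋆ ∂ g) h n) ⟩
  ((∂ f ⋆ g) ⋆ h) n + ((f ⋆ ∂ g) ⋆ h) n + ((f ⋆ g) ⋆ ∂ h) n
    ≡⟨ cong₂ _+_ (cong₂ _+_ (⋆-assoc (∂ f) g h n) (⋆-assoc f (∂ g) h n)) (⋆-assoc f g (∂ h) n) ⟩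
  (∂ f ⋆ (g ⋆ h)) n + (f ⋆ (∂ g ⋆ h)) n + (f ⋆ (g ⋆ ∂ h)) n
    ≡⟨ ℤ.+-assoc ((∂ f ⋆ (g ⋆ h)) n) ((f ⋆ (∂ g ⋆ h)) n) ((f ⋆ (g ⋆ ∂ h)) n) ⟩
  (∂ f ⋆ (g ⋆ h)) n + ((f ⋆ (∂ g ⋆ h)) n + (f ⋆ (g ⋆ ∂ h)) n)
    ≡⟨ cong (_+_ ((∂ f ⋆ (g ⋆ h)) n)) (⋆-distribˡ f (∂ g ⋆ h) (g ⋆ ∂ h) n) ⟨
  (∂ f ⋆ (g ⋆ h)) n + (f ⋆ ∂ (g ⋆ h)) n
    ∎
  where open ≡-Reasoning

⋆-negˡ : ∀ f g → (-ₛ f) ⋆ g ≗ -ₛ (f ⋆ g)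
⋆-negˡ f g zero    = sym (ℤ.neg-distribˡ-* (f 0) (g 0))
⋆-negˡ f g (suc n) =
  trans (cong₂ _+_ (⋆-negˡ (∂ f) g n) (⋆-negˡ f (∂ g) n))
        (sym (ℤ.neg-distrib-+ ((∂ f ⋆ g) n) ((f ⋆ ∂ g) n)))

ι-⋆ : ∀ c g n → (ι c ⋆ g) n ≡ c * g n
ι-⋆ c g zero    = refl
ι-⋆ c g (suc n) =
  trans (cong₂ _+_ (⋆-zeroˡ (λ _ → refl) n) (ι-⋆ c (∂ g) n)) (ℤ.+-identityˡ _)

mono-+ : ∀ a b k n → mono a k n + mono b k n ≡ mono (a + b) k n
mono-+ a b zero    zero    = refl
mono-+ a b zero    (suc n) = refl
mono-+ a b (suc k) zero    = refl
mono-+ a b (suc k) (suc n) = mono-+ a b k n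

scale-mono : ∀ a b k n → a * mono b k n ≡ mono (a * b) k n
scale-mono a b zero    zero    = refl
scale-mono a b zero    (suc n) = ℤ.*-zeroʳ a
scale-mono a b (suc k) zero    = ℤ.*-zeroʳ a
scale-mono a b (suc k) (suc n) = scale-mono a b k n

mono-at : ∀ c k → mono c k k ≡ c
mono-at c zero    = refl
mono-at c (suc k) = mono-at c k

X⋆mono : ∀ c k → X ⋆ mono c k ≗ mono (+ suc k * c) (suc k)
X⋆mono c k       zero    = ℤ.*-zeroˡ (mono c k 0)
X⋆mono c zero    (suc n) = begin
  (ι 1ℤ ⋆ mono c 0) n + (X ⋆ 0ₛ) n  ≡⟨ cong₂ _+_ (ι-⋆ 1ℤ (mono c 0) n) (⋆-zeroʳ (λ _ → refl) n) ⟩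
  1ℤ * mono c 0 n + 0ℤ              ≡⟨ ℤ.+-identityʳ _ ⟩
  1ℤ * mono c 0 n                   ≡⟨ scale-mono 1ℤ c 0 n ⟩
  mono (1ℤ * c) 0 n                 ∎
  where open ≡-Reasoning
X⋆mono c (suc k) (suc n) = begin
  (ι 1ℤ ⋆ mono c (suc k)) n + (X ⋆ mono c k) n
    ≡⟨ cong₂ _+_ (ι-⋆ 1ℤ (mono c (suc k)) n) (X⋆mono c k n) ⟩
  1ℤ * mono c (suc k) n + mono (+ suc k * c) (suc k) n
    ≡⟨ cong (_+ mono (+ suc k * c) (suc k) n) (scale-mono 1ℤ c (suc k) n) ⟩
  mono (1ℤ * c) (suc k) n + mono (+ suc k * c) (suc k) n
    ≡⟨ mono-+ (1ℤ * c) (+ suc k * c) (suc k) n ⟩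
  mono (1ℤ * c + + suc k * c) (suc k) n
    ≡⟨ cong (λ a → mono a (suc k) n) (ℤ.*-distribʳ-+ c 1ℤ (+ suc k)) ⟨
  mono (+ suc (suc k) * c) (suc k) n
    ∎
  where open ≡-Reasoning

VanishesAbove : ℕ → Seq → Set
VanishesAbove k f = ∀ n → k ℕ.< n → f n ≡ 0ℤ

mono-vanishesAbove : ∀ c k → VanishesAbove k (mono c k)
mono-vanishesAbove c zero    (suc n) _         = refl
mono-vanishesAbove c (suc k) (suc n) (s≤s k<n) = mono-vanishesAbove c k n k<n

∂-vanishesAbove : ∀ {k} → VanishesAbove (suc k) f → VanishesAbove k (∂ f)
∂-vanishesAbove f↑ n k<n = f↑ (suc n) (s≤s k<n)

∂-vanishes : VanishesAbove 0 f → ∂ f ≗ 0ₛ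
∂-vanishes f↑ n = f↑ (suc n) (s≤s z≤n)

⋆-vanishesAbove : ∀ k l → VanishesAbove k f → VanishesAbove l g →
                  VanishesAbove (k ℕ.+ l) (f ⋆ g)
⋆-vanishesAbove {f} {g} k l f↑ g↑ (suc n) (s≤s k+l≤n) =
  cong₂ _+_ (∂f⋆g k f↑ k+l≤n) (f⋆∂g l g↑ k+l≤n)
  where
  ∂f⋆g : ∀ k → VanishesAbove k f → k ℕ.+ l ℕ.≤ n → (∂ f ⋆ g) n ≡ 0ℤ
  ∂f⋆g zero    f↑ _  = ⋆-zeroˡ (∂-vanishes f↑) n
  ∂f⋆g (suc k) f↑ le = ⋆-vanishesAbove k l (∂-vanishesAbove f↑) g↑ n le
  f⋆∂g : ∀ l → VanishesAbove l g → k ℕ.+ l ℕ.≤ n → (f ⋆ ∂ g) n ≡ 0ℤ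
  f⋆∂g zero    g↑ _  = ⋆-zeroʳ (∂-vanishes g↑) n
  f⋆∂g (suc l) g↑ le =
    ⋆-vanishesAbove k l f↑ (∂-vanishesAbove g↑) n (subst (ℕ._≤ n) (ℕ.+-suc k l) le)

record Leading (k : ℕ) (f : Seq) : Set where
  constructor leading
  field
    coefficient-positive : 0ℤ < f k
    vanishes-above       : VanishesAbove k f

∂-leading : ∀ {k} → Leading (suc k) f → Leading k (∂ f)
∂-leading (leading f[k]>0 f↑) = leading f[k]>0 (∂-vanishesAbove f↑)

⋆-leading-pos : ∀ k l → Leading k f → Leading l g → 0ℤ < (f ⋆ g) (k ℕ.+ l)
⋆-leading-pos zero    zero    (leading f0>0 _) (leading g0>0 _) = *-pos f0>0 g0>0
⋆-leading-pos zero    (suc l) F@(leading _ f↑) G =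
  subst (0ℤ <_) (sym (i≡0⇒i+j≡j (⋆-zeroˡ (∂-vanishes f↑) l)))
        (⋆-leading-pos zero l F (∂-leading G))
⋆-leading-pos (suc k) zero    F G@(leading _ g↑) =
  subst (0ℤ <_) (sym (j≡0⇒i+j≡i (⋆-zeroʳ (∂-vanishes g↑) (k ℕ.+ 0))))
        (⋆-leading-pos k zero (∂-leading F) G)
⋆-leading-pos {f} {g} (suc k) (suc l) F G =
  +-pos (⋆-leading-pos k (suc l) (∂-leading F) G)
        (subst (λ n → 0ℤ < (f ⋆ ∂ g) n) (sym (ℕ.+-suc k l))
               (⋆-leading-pos (suc k) l F (∂-leading G)))

⋆-leading : ∀ {k l} → Leading k f → Leading l g → Leading (k ℕ.+ l) (f ⋆ g)
⋆-leading {k = k} {l} F@(leading _ f↑) G@(leading _ g↑) =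
  leading (⋆-leading-pos k l F G) (⋆-vanishesAbove k l f↑ g↑)

record Poly : Set where
  constructor mkPoly
  field
    coeff          : Seq
    bound          : ℕ
    coeff-vanishes : VanishesAbove bound coeff
open Poly public

private
  variable
    x x′ y y′ z : Poly

infix 4 _≈_

record _≈_ (x y : Poly) : Set where
  constructor coeffwise
  field coeff-≗ : coeff x ≗ coeff y
open _≈_ public

≈-isEquivalence : IsEquivalence _≈_
≈-isEquivalence = record
  { refl  = coeffwise λ _ → refl
  ; sym   = λ (coeffwise x≗y) → coeffwise (sym ∘ x≗y)
  ; trans = λ (coeffwise x≗y) (coeffwise y≗z) → coeffwise λ n → trans (x≗y n) (y≗z n)
  }

open IsEquivalence ≈-isEquivalence public
  using () renaming (refl to ≈-refl; sym to ≈-sym; trans to ≈-trans)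

≈-setoid : Setoid 0ℓ 0ℓ
≈-setoid = record { isEquivalence = ≈-isEquivalence }

module ≈-Reasoning = SetoidReasoning ≈-setoid

≡⇒≈ : x ≡ y → x ≈ y
≡⇒≈ refl = ≈-refl

≈-stable : Stable (x ≈ y)
≈-stable {x} {y} ¬¬x≈y = coeffwise λ n →
  decidable-stable (coeff x n ℤ.≟ coeff y n) (λ x≢y → ¬¬x≈y (x≢y ∘ (λ x≈y → coeff-≗ x≈y n)))

infixl 6 _⊕_ _⊖_
infixl 7 _⊗_

0ₚ : Poly
0ₚ = mkPoly 0ₛ 0 (λ _ _ → refl)

monomial : ℤ → ℕ → Poly
monomial c k = mkPoly (mono c k) k (mono-vanishesAbove c k)

constant : ℤ → Poly
constant c = monomial c 0

_⊕_ : Poly → Poly → Poly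
x ⊕ y = mkPoly (coeff x +ₛ coeff y) (bound x ℕ.⊔ bound y) λ n b<n →
  cong₂ _+_ (coeff-vanishes x n (ℕ.m⊔n<o⇒m<o (bound x) (bound y) b<n))
            (coeff-vanishes y n (ℕ.m⊔n<o⇒n<o (bound x) (bound y) b<n))

⊖_ : Poly → Poly
⊖ x = mkPoly (-ₛ coeff x) (bound x) λ n b<n → cong -_ (coeff-vanishes x n b<n)

_⊖_ : Poly → Poly → Poly
x ⊖ y = x ⊕ ⊖ y

_⊗_ : Poly → Poly → Poly
x ⊗ y = mkPoly (coeff x ⋆ coeff y) (bound x ℕ.+ bound y)
  (⋆-vanishesAbove (bound x) (bound y) (coeff-vanishes x) (coeff-vanishes y))

⊕-cong : x ≈ x′ → y ≈ y′ → x ⊕ y ≈ x′ ⊕ y′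
⊕-cong (coeffwise x≗x′) (coeffwise y≗y′) = coeffwise λ n → cong₂ _+_ (x≗x′ n) (y≗y′ n)

⊖-cong : x ≈ x′ → ⊖ x ≈ ⊖ x′
⊖-cong (coeffwise x≗x′) = coeffwise (cong -_ ∘ x≗x′)

⊗-cong : x ≈ x′ → y ≈ y′ → x ⊗ y ≈ x′ ⊗ y′
⊗-cong (coeffwise x≗x′) (coeffwise y≗y′) = coeffwise (⋆-cong x≗x′ y≗y′)

⊕-comm : ∀ x y → x ⊕ y ≈ y ⊕ x
⊕-comm x y = coeffwise λ n → ℤ.+-comm (coeff x n) (coeff y n)

⊕-assoc : ∀ x y z → (x ⊕ y) ⊕ z ≈ x ⊕ (y ⊕ z)
⊕-assoc x y z = coeffwise λ n → ℤ.+-assoc (coeff x n) (coeff y n) (coeff z n)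

⊕-identityʳ : ∀ x → x ⊕ 0ₚ ≈ x
⊕-identityʳ x = coeffwise λ n → ℤ.+-identityʳ (coeff x n)

⊗-comm : ∀ x y → x ⊗ y ≈ y ⊗ x
⊗-comm x y = coeffwise (⋆-comm (coeff x) (coeff y))

⊗-assoc : ∀ x y z → (x ⊗ y) ⊗ z ≈ x ⊗ (y ⊗ z)
⊗-assoc x y z = coeffwise (⋆-assoc (coeff x) (coeff y) (coeff z))

⊗-distribˡ : ∀ x y z → x ⊗ (y ⊕ z) ≈ x ⊗ y ⊕ x ⊗ z
⊗-distribˡ x y z = coeffwise (⋆-distribˡ (coeff x) (coeff y) (coeff z))

⊗-distribʳ-⊖ : ∀ x y z → (y ⊖ x) ⊗ z ≈ y ⊗ z ⊖ x ⊗ z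
⊗-distribʳ-⊖ x y z = coeffwise λ n →
  trans (⋆-distribʳ (coeff y) (-ₛ coeff x) (coeff z) n)
        (cong (_+_ ((coeff y ⋆ coeff z) n)) (⋆-negˡ (coeff x) (coeff z) n))

⊗-identityʳ : ∀ x → x ⊗ constant 1ℤ ≈ x
⊗-identityʳ x = coeffwise λ n →
  trans (⋆-comm (coeff x) (ι 1ℤ) n) (trans (ι-⋆ 1ℤ (coeff x) n) (ℤ.*-identityˡ (coeff x n)))

⊗-zeroʳ : ∀ x → x ⊗ 0ₚ ≈ 0ₚ
⊗-zeroʳ x = coeffwise (⋆-zeroʳ λ _ → refl)

constant-⊕ : ∀ a b → constant a ⊕ constant b ≈ constant (a + b)
constant-⊕ a b = coeffwise (mono-+ a b 0)

constant-0 : constant 0ℤ ≈ 0ₚ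
constant-0 = coeffwise λ where
  zero    → refl
  (suc n) → refl

constant-⊖ : ∀ a b → constant a ⊖ constant b ≈ constant (a - b)
constant-⊖ a b = coeffwise λ where
  zero    → refl
  (suc n) → refl

constant-⊗ : ∀ a b → constant a ⊗ constant b ≈ constant (a * b)
constant-⊗ a b = coeffwise λ n → trans (ι-⋆ a (ι b) n) (scale-mono a b 0 n)

record Positive (x : Poly) : Set where
  constructor positive
  field
    degree    : ℕ
    isLeading : Leading degree (coeff x)

monomial-positive : 0ℤ < i → ∀ k → Positive (monomial i k)
monomial-positive {i} i>0 k =
  positive k (leading (subst (0ℤ <_) (sym (mono-at i k)) i>0) (mono-vanishesAbove i k))

constant-positive : 0ℤ < i → Positive (constant i)
constant-positive i>0 = monomial-positive i>0 0

Leading-resp : ∀ {k f g} → f ≗ g → Leading k f → Leading k g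
Leading-resp {k} f≗g (leading fk>0 f↑) =
  leading (subst (0ℤ <_) (f≗g k) fk>0) (λ n k<n → trans (sym (f≗g n)) (f↑ n k<n))

Positive-resp : x ≈ y → Positive x → Positive y
Positive-resp (coeffwise x≗y) (positive k x-leading) = positive k (Leading-resp x≗y x-leading)

+ₛ-leading : ∀ {k l f g} → VanishesAbove k f → k ℕ.< l → Leading l g → Leading l (f +ₛ g)
+ₛ-leading f↑ k<l (leading gl>0 g↑) =
  leading (subst (0ℤ <_) (sym (i≡0⇒i+j≡j (f↑ _ k<l))) gl>0)
          (λ n l<n → cong₂ _+_ (f↑ n (ℕ.<-trans k<l l<n)) (g↑ n l<n))

⊕-positive : Positive x → Positive y → Positive (x ⊕ y)
⊕-positive {x} {y} (positive k (leading xk>0 x↑)) (positive l Ly@(leading yl>0 y↑))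
  with ℕ.<-cmp k l
... | tri< k<l _ _ = positive l (+ₛ-leading x↑ k<l Ly)
... | tri≈ _ refl _ =
  positive k (leading (+-pos xk>0 yl>0) (λ n k<n → cong₂ _+_ (x↑ n k<n) (y↑ n k<n)))
... | tri> _ _ l<k = Positive-resp (⊕-comm y x)
  (positive k (+ₛ-leading y↑ l<k (leading xk>0 x↑)))

⊗-positive : Positive x → Positive y → Positive (x ⊗ y)
⊗-positive (positive k x-leading) (positive l y-leading) =
  positive (k ℕ.+ l) (⋆-leading x-leading y-leading)

Positive⇒≉0 : Positive x → ¬ (x ≈ 0ₚ)
Positive⇒≉0 (positive k (leading xk>0 _)) (coeffwise x≗0) = ℤ.<-irrefl (sym (x≗0 k)) xk>0

⊖-inverseʳ : ∀ x → x ⊖ x ≈ 0ₚ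
⊖-inverseʳ x = coeffwise λ n → ℤ.+-inverseʳ (coeff x n)

¬Positive-both : Positive x → ¬ Positive (⊖ x)
¬Positive-both {x} x>0 ⊖x>0 = Positive⇒≉0 (⊕-positive x>0 ⊖x>0) (⊖-inverseʳ x)

lastNonzero : ∀ b f → VanishesAbove b f →
              f ≗ 0ₛ ⊎ Σ[ k ∈ ℕ ] f k ≢ 0ℤ × VanishesAbove k f
lastNonzero b f f↑ with f b ℤ.≟ 0ℤ
... | no  fb≢0 = inj₂ (b , fb≢0 , f↑)
lastNonzero zero    f f↑ | yes f0≡0 = inj₁ λ where
  zero    → f0≡0
  (suc n) → f↑ (suc n) (s≤s z≤n)
lastNonzero (suc b) f f↑ | yes fb≡0 = lastNonzero b f λ n b<n →
  case (ℕ.m≤n⇒m<n∨m≡n b<n)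
  where
  case : ∀ {n} → suc b ℕ.< n ⊎ suc b ≡ n → f n ≡ 0ℤ
  case (inj₁ b+1<n) = f↑ _ b+1<n
  case (inj₂ refl)  = fb≡0

data Sign (x : Poly) : Set where
  null : x ≈ 0ₚ → Sign x
  pos  : Positive x → Sign x
  neg  : Positive (⊖ x) → Sign x

sign : ∀ x → Sign x
sign x with lastNonzero (bound x) (coeff x) (coeff-vanishes x)
... | inj₁ x≗0 = null (coeffwise x≗0)
... | inj₂ (k , xk≢0 , x↑) with ℤ.<-cmp 0ℤ (coeff x k)
...   | tri< xk>0 _ _ = pos (positive k (leading xk>0 x↑))
...   | tri≈ _ 0≡xk _ = ⊥-elim (xk≢0 (sym 0≡xk))
...   | tri> _ _ xk<0 =
  neg (positive k (leading (ℤ.neg-mono-< xk<0) (λ n k<n → cong -_ (x↑ n k<n))))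

positive? : ∀ x → Dec (Positive x)
positive? x with sign x
... | null x≈0 = no λ x>0 → Positive⇒≉0 x>0 x≈0
... | pos x>0  = yes x>0
... | neg ⊖x>0 = no λ x>0 → ¬Positive-both x>0 ⊖x>0

infix 4 _≺_

record _≺_ (x y : Poly) : Set where
  constructor ≺-by
  field difference-positive : Positive (y ⊖ x)

≺-stable : Stable (x ≺ y)
≺-stable {x} {y} ¬¬x≺y =
  ≺-by (decidable-stable (positive? (y ⊖ x)) λ ¬d → ¬¬x≺y λ (≺-by d) → ¬d d)

≺-resp : x ≈ x′ → y ≈ y′ → x ≺ y → x′ ≺ y′
≺-resp x≈x′ y≈y′ (≺-by d) = ≺-by (Positive-resp (⊕-cong y≈y′ (⊖-cong x≈x′)) d)

≺-trans : x ≺ y → y ≺ z → x ≺ z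
≺-trans {x} {y} {z} (≺-by y-x) (≺-by z-y) =
  ≺-by (Positive-resp (coeffwise λ n → telescope (coeff x n) (coeff y n) (coeff z n))
                      (⊕-positive z-y y-x))
  where
  telescope : ∀ a b c → (c - b) + (b - a) ≡ c - a
  telescope = solve-∀

≺-irrefl : ¬ (x ≺ x)
≺-irrefl {x} (≺-by x-x) = Positive⇒≉0 x-x (⊖-inverseʳ x)

≺-asym : x ≺ y → ¬ (y ≺ x)
≺-asym x≺y y≺x = ≺-irrefl (≺-trans x≺y y≺x)

≺-cmp : Trichotomous _≈_ _≺_
≺-cmp x y with sign (y ⊖ x)
... | null y-x≈0 = tri≈ (λ x≺y → ≺-irrefl (≺-resp ≈-refl (≈-sym x≈y) x≺y)) x≈y
                        (λ y≺x → ≺-irrefl (≺-resp (≈-sym x≈y) ≈-refl y≺x))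
  where
  x≈y : x ≈ y
  x≈y = coeffwise λ n → sym (ℤ.i-j≡0⇒i≡j (coeff y n) (coeff x n) (coeff-≗ y-x≈0 n))
... | pos y-x>0 = tri< (≺-by y-x>0) (λ x≈y → ≺-irrefl (≺-resp ≈-refl (≈-sym x≈y) (≺-by y-x>0)))
                       (≺-asym (≺-by y-x>0))
... | neg x-y>0 = tri> (≺-asym y≺x) (λ x≈y → ≺-irrefl (≺-resp (≈-sym x≈y) ≈-refl y≺x)) y≺x
  where
  flip : ∀ a b → - (b - a) ≡ a - b
  flip = solve-∀
  y≺x : y ≺ x
  y≺x = ≺-by (Positive-resp (coeffwise λ n → flip (coeff x n) (coeff y n)) x-y>0)

⊕-monoˡ-≺ : ∀ z → x ≺ y → x ⊕ z ≺ y ⊕ z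
⊕-monoˡ-≺ {x} {y} z (≺-by y-x) =
  ≺-by (Positive-resp (coeffwise λ n → cancel (coeff x n) (coeff y n) (coeff z n)) y-x)
  where
  cancel : ∀ a b c → b - a ≡ (b + c) - (a + c)
  cancel = solve-∀

⊗-monoˡ-≺ : Positive z → x ≺ y → x ⊗ z ≺ y ⊗ z
⊗-monoˡ-≺ {z} {x} {y} z>0 (≺-by y-x) =
  ≺-by (Positive-resp (⊗-distribʳ-⊖ x y z) (⊗-positive y-x z>0))

constant-mono-≺ : i < j → constant i ≺ constant j
constant-mono-≺ {i} {j} i<j = ≺-by (Positive-resp (≈-sym (constant-⊖ j i))
  (constant-positive (subst (_< j - i) (ℤ.+-inverseʳ i) (ℤ.+-monoˡ-< (- i) i<j))))

⊗-monoʳ-≺ : Positive x → y ≺ y′ → x ⊗ y ≺ x ⊗ y′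
⊗-monoʳ-≺ {x} {y} {y′} x>0 y≺y′ = ≺-resp (⊗-comm y x) (⊗-comm y′ x) (⊗-monoˡ-≺ x>0 y≺y′)

0≺⇒Positive : 0ₚ ≺ x → Positive x
0≺⇒Positive {x} (≺-by x-0) = Positive-resp (⊕-identityʳ x) x-0

Positive⇒0≺ : Positive x → 0ₚ ≺ x
Positive⇒0≺ {x} x>0 = ≺-by (Positive-resp (≈-sym (⊕-identityʳ x)) x>0)

NonNegative : Poly → Set
NonNegative x = x ≈ 0ₚ ⊎ Positive x

≈0-⊕ : x ≈ 0ₚ → x ⊕ y ≈ y
≈0-⊕ (coeffwise x≗0) = coeffwise λ n → i≡0⇒i+j≡j (x≗0 n)

≈0-⊗ : x ≈ 0ₚ → x ⊗ y ≈ 0ₚ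
≈0-⊗ (coeffwise x≗0) = coeffwise (⋆-zeroˡ x≗0)

⊕-nonNegative : NonNegative x → NonNegative y → NonNegative (x ⊕ y)
⊕-nonNegative (inj₁ x≈0) (inj₁ y≈0) = inj₁ (≈-trans (≈0-⊕ x≈0) y≈0)
⊕-nonNegative (inj₁ x≈0) (inj₂ y>0) = inj₂ (Positive-resp (≈-sym (≈0-⊕ x≈0)) y>0)
⊕-nonNegative {x} {y} (inj₂ x>0) (inj₁ y≈0) =
  inj₂ (Positive-resp (≈-sym (≈-trans (⊕-comm x y) (≈0-⊕ y≈0))) x>0)
⊕-nonNegative (inj₂ x>0) (inj₂ y>0) = inj₂ (⊕-positive x>0 y>0)

⊗-nonNegative : NonNegative x → NonNegative y → NonNegative (x ⊗ y)
⊗-nonNegative (inj₁ x≈0) _ = inj₁ (≈0-⊗ x≈0)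
⊗-nonNegative {x} {y} (inj₂ _) (inj₁ y≈0) = inj₁ (≈-trans (⊗-comm x y) (≈0-⊗ y≈0))
⊗-nonNegative (inj₂ x>0) (inj₂ y>0) = inj₂ (⊗-positive x>0 y>0)

record Poly⁺ : Set where
  constructor _,_
  field
    poly   : Poly
    nonneg : NonNegative poly
open Poly⁺ public

infixl 6 _+⁺_
infixl 7 _*⁺_

_+⁺_ : Poly⁺ → Poly⁺ → Poly⁺
(x , x≥0) +⁺ (y , y≥0) = x ⊕ y , ⊕-nonNegative x≥0 y≥0

_*⁺_ : Poly⁺ → Poly⁺ → Poly⁺
(x , x≥0) *⁺ (y , y≥0) = x ⊗ y , ⊗-nonNegative x≥0 y≥0

constant-nonNegative : ∀ n → NonNegative (constant (+ n))
constant-nonNegative zero    = inj₁ constant-0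
constant-nonNegative (suc n) = inj₂ (constant-positive (+<+ (s≤s z≤n)))

⌜_⌝ : ℕ → Poly⁺
⌜ n ⌝ = constant (+ n) , constant-nonNegative n

0⁺ : Poly⁺
0⁺ = 0ₚ , inj₁ ≈-refl

ℳ : Structure
ℳ = record
  { Carrier       = Poly⁺
  ; _≈_           = _≈_ on poly
  ; _<_           = _≺_ on poly
  ; _+_           = _+⁺_
  ; _*_           = _*⁺_
  ; 0#            = 0⁺
  ; 1#            = ⌜ 1 ⌝
  ; isEquivalence = On.isEquivalence poly ≈-isEquivalence
  ; +-cong        = ⊕-cong
  ; *-cong        = ⊗-cong
  ; <-resp        = ≺-resp
  ; ≈-stable      = ≈-stable
  ; <-stable      = ≺-stable
  }

open Semantics ℳ public

private
  variable
    a b d m t v w : Poly⁺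

⌜⌝-+ : ∀ k n → poly ⌜ k ⌝ ⊕ poly ⌜ n ⌝ ≈ poly ⌜ k ℕ.+ n ⌝
⌜⌝-+ k n = constant-⊕ (+ k) (+ n)

⌜⌝-* : ∀ k n → poly ⌜ k ⌝ ⊗ poly ⌜ n ⌝ ≈ poly ⌜ k ℕ.* n ⌝
⌜⌝-* k n = ≈-trans (constant-⊗ (+ k) (+ n)) (≡⇒≈ (cong constant (sym (ℤ.pos-* k n))))

⌜⌝-injective : poly ⌜ k ⌝ ≈ poly ⌜ n ⌝ → k ≡ n
⌜⌝-injective k≈n = ℤ.+-injective (coeff-≗ k≈n 0)

⌜⌝-mono-≺ : k ℕ.< n → poly ⌜ k ⌝ ≺ poly ⌜ n ⌝
⌜⌝-mono-≺ k<n = constant-mono-≺ (+<+ k<n)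

⌜⌝-cancel-≺ : poly ⌜ k ⌝ ≺ poly ⌜ n ⌝ → k ℕ.< n
⌜⌝-cancel-≺ {k} {n} k≺n with ℕ.<-cmp k n
... | tri< k<n _ _ = k<n
... | tri≈ _ refl _ = ⊥-elim (≺-irrefl k≺n)
... | tri> _ _ n<k = ⊥-elim (≺-asym k≺n (⌜⌝-mono-≺ n<k))

data Size (a : Poly⁺) : Set where
  standard : ∀ n → poly a ≈ poly ⌜ n ⌝ → Size a
  infinite : ∀ k → Leading (suc k) (coeff (poly a)) → Size a

size : ∀ a → Size a
size (a , inj₁ a≈0) = standard 0 (≈-trans a≈0 (≈-sym constant-0))
size (a , inj₂ (positive (suc k) a-leading)) = infinite k a-leading
size (a , inj₂ (positive zero (leading a₀>0 a↑))) with 0<⇒+suc a₀>0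
... | n , a₀≡1+n = standard (suc n) (coeffwise λ where
  zero    → a₀≡1+n
  (suc i) → a↑ (suc i) (s≤s z≤n))

infinite-dominates : Leading (suc k) (coeff x) → ∀ c → constant c ≺ x
infinite-dominates {k} (leading x>0 x↑) c = ≺-by (positive (suc k) (leading
  (subst (0ℤ <_) (sym (ℤ.+-identityʳ _)) x>0)
  λ { (suc n) k<n → cong (_+ 0ℤ) (x↑ (suc n) k<n) }))

infinite-≉-constant : ∀ {c} → Leading (suc k) (coeff x) → ¬ (x ≈ constant c)
infinite-≉-constant x-leading x≈c = ≺-irrefl (≺-resp ≈-refl x≈c (infinite-dominates x-leading _))

Positive⇒1≼ : Positive (poly a) → ¬ poly ⌜ 1 ⌝ ≺ poly a → poly ⌜ 1 ⌝ ≈ poly a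
Positive⇒1≼ {a} a>0 1≮a with size a
... | standard 0 a≈0 = ⊥-elim (Positive⇒≉0 a>0 (≈-trans a≈0 constant-0))
... | standard 1 a≈1 = ≈-sym a≈1
... | standard (suc (suc n)) a≈n =
  ⊥-elim (1≮a (≺-resp ≈-refl (≈-sym a≈n) (⌜⌝-mono-≺ (s≤s (s≤s z≤n)))))
... | infinite k a-leading = ⊥-elim (1≮a (infinite-dominates a-leading _))

nothing-between-1-and-2 : poly ⌜ 1 ⌝ ≺ poly t → ¬ (poly t ≺ poly ⌜ 2 ⌝)
nothing-between-1-and-2 {t} 1<t t<2 with size t
... | standard n t≈n = ℕ.<⇒≱ (⌜⌝-cancel-≺ (≺-resp ≈-refl t≈n 1<t))
                               (ℕ.≤-pred (⌜⌝-cancel-≺ (≺-resp t≈n ≈-refl t<2)))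
... | infinite k t-leading = ≺-asym t<2 (infinite-dominates t-leading _)

⌜⌝∣⇒∣coeff : poly ⌜ q ⌝ ⊗ poly w ≈ x → ∀ n → q ℕ.∣ ∣ coeff x n ∣
⌜⌝∣⇒∣coeff {q} {w} {x} (coeffwise qw≗x) n = ℕ.divides ∣ coeff (poly w) n ∣ (begin
  ∣ coeff x n ∣                        ≡⟨ cong ∣_∣ (qw≗x n) ⟨
  ∣ (ι (+ q) ⋆ coeff (poly w)) n ∣     ≡⟨ cong ∣_∣ (ι-⋆ (+ q) (coeff (poly w)) n) ⟩
  ∣ + q * coeff (poly w) n ∣           ≡⟨ ℤ.abs-* (+ q) (coeff (poly w) n) ⟩
  q ℕ.* ∣ coeff (poly w) n ∣           ≡⟨ ℕ.*-comm q ∣ coeff (poly w) n ∣ ⟩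
  ∣ coeff (poly w) n ∣ ℕ.* q           ∎)
  where open ≡-Reasoning

⌜⌝∤-by-coeff : ∀ a n {c} → coeff (poly a) n ≡ + c → ¬ q ℕ.∣ c → ⌜ q ⌝ ∤ a
⌜⌝∤-by-coeff {q} a n aₙ≡c q∤c w qw≈a =
  q∤c (subst (λ i → q ℕ.∣ ∣ i ∣) aₙ≡c (⌜⌝∣⇒∣coeff {w = w} qw≈a n))

⊗-cancelˡ : Positive x → x ⊗ y ≈ x ⊗ y′ → y ≈ y′
⊗-cancelˡ {x} {y} {y′} x>0 xy≈xy′ with ≺-cmp y y′
... | tri≈ _ y≈y′ _ = y≈y′
... | tri< y≺y′ _ _ = ⊥-elim (≺-irrefl (≺-resp xy≈xy′ ≈-refl (⊗-monoʳ-≺ x>0 y≺y′)))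
... | tri> _ _ y′≺y = ⊥-elim (≺-irrefl (≺-resp ≈-refl xy≈xy′ (⊗-monoʳ-≺ x>0 y′≺y)))

⊗≈⌜suc⌝⇒positive : poly a ⊗ poly b ≈ poly ⌜ suc n ⌝ → Positive (poly a)
⊗≈⌜suc⌝⇒positive {a} {b} ab≈n with nonneg a
... | inj₂ a>0 = a>0
... | inj₁ a≈0 with coeff-≗ (≈-trans (≈-sym (≈0-⊗ {y = poly b} a≈0)) ab≈n) 0
...   | ()

⊗≈constant⇒standard : Positive (poly b) → ∀ {c} → poly a ⊗ poly b ≈ constant c →
                  Σ[ i ∈ ℕ ] poly a ≈ poly ⌜ i ⌝
⊗≈constant⇒standard {b} {a} (positive l b-leading) ab≈c with size a
... | standard i a≈i = i , a≈i
... | infinite k a-leading = ⊥-elim (infinite-≉-constant (⋆-leading a-leading b-leading) ab≈c)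

divisor-of-standard : poly a ⊗ poly b ≈ poly ⌜ suc n ⌝ →
                      Σ[ i ∈ ℕ ] poly a ≈ poly ⌜ i ⌝ × i ℕ.∣ suc n
divisor-of-standard {a} {b} {n} ab≈n
  with ⊗≈constant⇒standard {b} {a} (⊗≈⌜suc⌝⇒positive {b} {a} ba≈n) ab≈n
     | ⊗≈constant⇒standard {a} {b} (⊗≈⌜suc⌝⇒positive {a} {b} ab≈n) ba≈n
  where
  ba≈n : poly b ⊗ poly a ≈ poly ⌜ suc n ⌝
  ba≈n = ≈-trans (⊗-comm (poly b) (poly a)) ab≈n
... | i , a≈i | j , b≈j = i , a≈i , ℕ.divides j (trans (sym ij≡n) (ℕ.*-comm i j))
  where
  ij≡n : i ℕ.* j ≡ suc n
  ij≡n = ⌜⌝-injective {i ℕ.* j} {suc n} (begin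
    poly ⌜ i ℕ.* j ⌝         ≈⟨ ⌜⌝-* i j ⟨
    poly ⌜ i ⌝ ⊗ poly ⌜ j ⌝  ≈⟨ ⊗-cong a≈i b≈j ⟨
    poly a ⊗ poly b          ≈⟨ ab≈n ⟩
    poly ⌜ suc n ⌝           ∎)
    where open ≈-Reasoning

divisor-of-prime : Prime q → poly d ⊗ poly w ≈ poly ⌜ q ⌝ →
                   poly d ≈ poly ⌜ 1 ⌝ ⊎ poly d ≈ poly ⌜ q ⌝
divisor-of-prime {suc q} {d} {w} q-prime dw≈q with divisor-of-standard {d} {w} dw≈q
... | i , d≈i , i∣q with prime⇒irreducible q-prime i∣q
...   | inj₁ refl = inj₁ d≈i
...   | inj₂ refl = inj₂ d≈i

X^[_] : ℕ → Poly⁺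
X^[ k ] = monomial 1ℤ k , inj₂ (monomial-positive (+<+ (s≤s z≤n)) k)

X-⊗-X^[k] : ∀ k → poly X^[ 1 ] ⊗ poly X^[ k ] ≈ poly ⌜ suc k ⌝ ⊗ poly X^[ suc k ]
X-⊗-X^[k] k = coeffwise λ n → trans (X⋆mono 1ℤ k n)
  (sym (trans (ι-⋆ (+ suc k) (mono 1ℤ (suc k)) n) (scale-mono (+ suc k) 1ℤ (suc k) n)))

⌜⌝∤X^[k] : 1 ℕ.< q → ∀ k → ⌜ q ⌝ ∤ X^[ k ]
⌜⌝∤X^[k] q>1 k = ⌜⌝∤-by-coeff X^[ k ] k (mono-at 1ℤ k) (1<⇒∤1 q>1)

⌜⌝-not-prime : 1 ℕ.< q → ¬ IsPrime ⌜ q ⌝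
⌜⌝-not-prime {suc zero} (s≤s ())
⌜⌝-not-prime {suc (suc k)} q>1 q-prime = q-prime λ _ q∣ab⇒ →
  q∣ab⇒ X^[ 1 ] X^[ suc k ] X^[ suc (suc k) ] (≈-sym (X-⊗-X^[k] (suc k)))
        (λ q∣X → q∣X (⌜⌝∤X^[k] q>1 1)) (⌜⌝∤X^[k] q>1 (suc k))

IsPrime-resp : poly a ≈ poly b → IsPrime a → IsPrime b
IsPrime-resp {a} {b} a≈b = Equivalence.to (⟦⟧-cong (prime v0) {a ∷ λ _ → a} {b ∷ λ _ → a} λ where
  zero    → a≈b
  (suc n) → ≈-refl)

⌜⌝-not-unit : 1 ℕ.< q → ⌜ q ⌝ ∤ ⌜ 1 ⌝
⌜⌝-not-unit q>1 = ⌜⌝∤-by-coeff ⌜ 1 ⌝ 0 refl (1<⇒∤1 q>1)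

-- a prime v with v = q z would divide q (impossible) or z, making q a unit
⌜prime⌝∤prime : Prime q → IsPrime v → ⌜ q ⌝ ∤ v
⌜prime⌝∤prime {q} {v} q-prime v-prime z qz≈v = v-prime λ 1<v v∣ab⇒ →
  v∣ab⇒ ⌜ q ⌝ z ⌜ 1 ⌝ (≈-trans (⊗-identityʳ (poly v)) (≈-sym qz≈v)) (v∤q 1<v) λ w vw≈z →
    ⌜⌝-not-unit (prime⇒1< q-prime) w (≈-sym (⊗-cancelˡ (v>0 1<v) (begin
      poly v ⊗ poly ⌜ 1 ⌝               ≈⟨ ⊗-identityʳ (poly v) ⟩
      poly v                            ≈⟨ qz≈v ⟨
      poly ⌜ q ⌝ ⊗ poly z               ≈⟨ ⊗-cong ≈-refl vw≈z ⟨
      poly ⌜ q ⌝ ⊗ (poly v ⊗ poly w)    ≈⟨ ⊗-assoc (poly ⌜ q ⌝) (poly v) (poly w) ⟨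
      poly ⌜ q ⌝ ⊗ poly v ⊗ poly w      ≈⟨ ⊗-cong (⊗-comm (poly ⌜ q ⌝) (poly v)) ≈-refl ⟩
      poly v ⊗ poly ⌜ q ⌝ ⊗ poly w      ≈⟨ ⊗-assoc (poly v) (poly ⌜ q ⌝) (poly w) ⟩
      poly v ⊗ (poly ⌜ q ⌝ ⊗ poly w)    ∎)))
  where
  open ≈-Reasoning
  v>0 : poly ⌜ 1 ⌝ ≺ poly v → Positive (poly v)
  v>0 1<v = 0≺⇒Positive (≺-trans (Positive⇒0≺ (constant-positive (+<+ (s≤s z≤n)))) 1<v)
  v∤q : poly ⌜ 1 ⌝ ≺ poly v → ¬ v ∣ ⌜ q ⌝
  v∤q 1<v v∣q = v∣q λ w vw≈q → case (divisor-of-prime {q} {v} {w} q-prime vw≈q)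
    where
    case : poly v ≈ poly ⌜ 1 ⌝ ⊎ poly v ≈ poly ⌜ q ⌝ → ⊥
    case (inj₁ v≈1) = ≺-irrefl (≺-resp ≈-refl v≈1 1<v)
    case (inj₂ v≈q) = ⌜⌝-not-prime (prime⇒1< q-prime) (IsPrime-resp {v} {⌜ q ⌝} v≈q v-prime)

⌜prime⌝-coprime : Prime q → ⌜ q ⌝ ∤ a → Coprime ⌜ q ⌝ a
⌜prime⌝-coprime {q} {a} q-prime q∤a d d∣q∧d∣a =
  ≈-stable λ d≉1 → d∣q∧d∣a λ d∣q d∣a → d∣q λ z dz≈q →
    case d≉1 d∣a (divisor-of-prime {q} {d} {z} q-prime dz≈q)
  where
  case : ¬ poly d ≈ poly ⌜ 1 ⌝ → d ∣ a → poly d ≈ poly ⌜ 1 ⌝ ⊎ poly d ≈ poly ⌜ q ⌝ → ⊥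
  case d≉1 _   (inj₁ d≈1) = d≉1 d≈1
  case _   d∣a (inj₂ d≈q) = d∣a λ w dw≈a → q∤a w (≈-trans (⊗-cong (≈-sym d≈q) ≈-refl) dw≈a)

prime-nondivisor-below : poly ⌜ 2 ⌝ ≺ poly m →
  Σ[ q ∈ ℕ ] Prime q × poly ⌜ q ⌝ ≺ poly m × ⌜ q ⌝ ∤ m
prime-nondivisor-below {m} 2<m with size m
... | standard n m≈n = below-standard n (⌜⌝-cancel-≺ (≺-resp ≈-refl m≈n 2<m)) m≈n
  where
  below-standard : ∀ n → 2 ℕ.< n → poly m ≈ poly ⌜ n ⌝ →
    Σ[ q ∈ ℕ ] Prime q × poly ⌜ q ⌝ ≺ poly m × ⌜ q ⌝ ∤ m
  below-standard 1 (s≤s ())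
  below-standard 2 (s≤s (s≤s ()))
  below-standard (suc n@(suc (suc _))) _ m≈n with primeDivisor {n} (s≤s (s≤s z≤n))
  ... | q , q-prime , q∣n = q , q-prime ,
    ≺-resp ≈-refl (≈-sym m≈n) (⌜⌝-mono-≺ (s≤s (ℕ.∣⇒≤ q∣n))) ,
    ⌜⌝∤-by-coeff m 0 (coeff-≗ m≈n 0) (1<⇒∤suc (prime⇒1< q-prime) q∣n)
... | infinite k m-leading@(leading m>0 _) with 0<⇒+suc m>0
...   | L , m≡1+L with primeDivisor {suc (suc L)} (s≤s (s≤s z≤n))
...     | q , q-prime , q∣2+L = q , q-prime , infinite-dominates m-leading (+ q) ,
  ⌜⌝∤-by-coeff m (suc k) m≡1+L λ q∣1+L → 1<⇒∤suc (prime⇒1< q-prime) q∣1+L q∣2+L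

⟦numeral⟧ : ∀ k {ρ} → poly (⟦ numeral k ⟧ₜ ρ) ≈ poly ⌜ k ⌝
⟦numeral⟧ zero          = ≈-sym constant-0
⟦numeral⟧ (suc zero)    = ≈-refl
⟦numeral⟧ (suc (suc k)) {ρ} = ≈-trans (⊕-cong (⟦numeral⟧ (suc k) {ρ}) (≈-refl {poly ⌜ 1 ⌝}))
  (≈-trans (⌜⌝-+ (suc k) 1) (≡⇒≈ (cong (λ n → constant (+ n)) (ℕ.+-comm (suc k) 1))))

square<5⇒≈2 : poly ⌜ 1 ⌝ ≺ poly a → poly a ⊗ poly a ≺ poly ⌜ 5 ⌝ → poly a ≈ poly ⌜ 2 ⌝
square<5⇒≈2 {a} 1<a a²<5 with size a
... | infinite k a-leading =
  ⊥-elim (≺-asym a²<5 (infinite-dominates (⋆-leading a-leading a-leading) (+ 5)))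
... | standard n a≈n = subst (λ n → poly a ≈ poly ⌜ n ⌝)
  (1<n∧n*n<5⇒n≡2 (⌜⌝-cancel-≺ (≺-resp ≈-refl a≈n 1<a))
                 (⌜⌝-cancel-≺ (≺-resp (≈-trans (⊗-cong a≈n a≈n) (⌜⌝-* n n)) ≈-refl a²<5)))
  a≈n

-- the witness n = 2 works for every p, prime or not
GSs-holds : ⊨ GSs
GSs-holds ρ p _ ¬∃ = ¬∃ ⌜ 2 ⌝ λ ¬both → ¬both 2-good no-good-above-2
  where
  2-good : ⟦ good v1 v0 ⟧ (⌜ 2 ⌝ ∷ p ∷ ρ)
  2-good t conditions =
    ⊥-elim (conditions λ 1<t rest → rest λ t<2 _ → nothing-between-1-and-2 {t} 1<t t<2)
  no-good-above-2 : ⟦ ∀' (v1 <' v0 ⇒ ¬' (good v2 v0)) ⟧ (⌜ 2 ⌝ ∷ p ∷ ρ)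
  no-good-above-2 m 2<m m-good with prime-nondivisor-below {m} 2<m
  ... | q , q-prime , q<m , q∤m =
    ⌜⌝-not-prime (prime⇒1< q-prime) (m-good ⌜ q ⌝ λ k → k 1<q λ k → k q<m λ k → k q⊥m primes⊥q)
    where
    1<q : poly ⌜ 1 ⌝ ≺ poly ⌜ q ⌝
    1<q = ⌜⌝-mono-≺ (prime⇒1< q-prime)
    q⊥m : Coprime ⌜ q ⌝ m
    q⊥m = ⌜prime⌝-coprime {q} {m} q-prime q∤m
    primes⊥q : ⟦ ∀' ((prime v0 ∧' (v0 ≤' var 4)) ⇒ relPrime v0 v1) ⟧ (⌜ q ⌝ ∷ m ∷ ⌜ 2 ⌝ ∷ p ∷ ρ)
    primes⊥q v v-prime∧v≤p = ⟦⟧-stable (relPrime v0 v1) (v ∷ ⌜ q ⌝ ∷ m ∷ ⌜ 2 ⌝ ∷ p ∷ ρ) λ ¬v⊥q →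
      v-prime∧v≤p λ v-prime _ → ¬v⊥q (Coprime-sym {⌜ q ⌝} {v}
        (⌜prime⌝-coprime {q} {v} q-prime (⌜prime⌝∤prime {q} {v} q-prime v-prime)))

PA⁻+GSs-sound : ∀ {φ} → PA⁻+GSs φ → ⊨ φ
PA⁻+GSs-sound a1  ρ x y z = ⊕-assoc (poly x) (poly y) (poly z)
PA⁻+GSs-sound a2  ρ x y   = ⊕-comm (poly x) (poly y)
PA⁻+GSs-sound a3  ρ x y z = ⊗-assoc (poly x) (poly y) (poly z)
PA⁻+GSs-sound a4  ρ x y   = ⊗-comm (poly x) (poly y)
PA⁻+GSs-sound a5  ρ x y z = ⊗-distribˡ (poly x) (poly y) (poly z)
PA⁻+GSs-sound a6  ρ x ¬both = ¬both (⊕-identityʳ (poly x)) (⊗-zeroʳ (poly x))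
PA⁻+GSs-sound a7  ρ x     = ⊗-identityʳ (poly x)
PA⁻+GSs-sound a8  ρ x y z x<y∧y<z = ≺-stable λ x≮z → x<y∧y<z λ x<y y<z → x≮z (≺-trans x<y y<z)
PA⁻+GSs-sound a9  ρ x     = ≺-irrefl
PA⁻+GSs-sound a10 ρ x y x≮y x≉y with ≺-cmp (poly x) (poly y)
... | tri< x<y _ _ = ⊥-elim (x≮y x<y)
... | tri≈ _ x≈y _ = ⊥-elim (x≉y x≈y)
... | tri> _ _ y<x = y<x
PA⁻+GSs-sound a11 ρ x y z = ⊕-monoˡ-≺ (poly z)
PA⁻+GSs-sound a12 ρ x y z z>0∧x<y =
  ≺-stable λ xz≮yz → z>0∧x<y λ z>0 x<y → xz≮yz (⊗-monoˡ-≺ (0≺⇒Positive z>0) x<y)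
PA⁻+GSs-sound a13 ρ x y (≺-by y-x>0) ¬∃ =
  ¬∃ (poly y ⊖ poly x , inj₂ y-x>0) (coeffwise λ n → cancel (coeff (poly x) n) (coeff (poly y) n))
  where
  cancel : ∀ a b → a + (b - a) ≡ b
  cancel = solve-∀
PA⁻+GSs-sound a14 ρ x ¬both = ¬both (Positive⇒0≺ (constant-positive (+<+ (s≤s z≤n)))) λ x>0 →
  Positive⇒1≼ {x} (0≺⇒Positive x>0)
PA⁻+GSs-sound a15 ρ x x≯0 with nonneg x
... | inj₁ x≈0 = x≈0
... | inj₂ x>0 = ⊥-elim (x≯0 (Positive⇒0≺ x>0))
PA⁻+GSs-sound gs  = GSs-holds

A18-fails : ∀ ρ → ¬ ⟦ A18 ⟧ ρ
A18-fails ρ a18 = a18 ⌜ 5 ⌝ 4<5 λ p conditions → conditions λ p-prime rest → rest λ p²<5 _ →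
  p-prime λ 1<p _ →
    ⌜⌝-not-prime (s≤s (s≤s z≤n)) (IsPrime-resp {p} {⌜ 2 ⌝} (square<5⇒≈2 {p} 1<p p²<5) p-prime)
  where
  4<5 : poly (⟦ numeral 4 ⟧ₜ (⌜ 5 ⌝ ∷ ρ)) ≺ poly ⌜ 5 ⌝
  4<5 = ≺-resp (≈-sym (⟦numeral⟧ 4 {⌜ 5 ⌝ ∷ ρ})) ≈-refl (⌜⌝-mono-≺ (ℕ.n<1+n 4))

mainTheorem6 : ¬ (PA⁻+GSs ⊢ A18)
mainTheorem6 ⊢A18 = A18-fails (λ _ → 0⁺) (sound PA⁻+GSs-sound ⊢A18 (λ _ → 0⁺))
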